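{- Let $D=\langle d_1,\ldots,d_n\rangle$ be an instance of $2$-Visits. If $D$ admits a feasible schedule, then it admits a feasible schedule (with a designation of primary and secondary visits) in which (1) every secondary visit is placed at a gap (equivalently, no primary visit is placed at a gap), and (2) the secondary visits appear in the schedule in order of non-decreasing induced deadline.
   Context: $2$-Visits (equivalent formulation): given a non-decreasing sequence of positive integers $d_1,\ldots,d_n$, a feasible schedule is a sequence of length $2n$ over positions $1,\ldots,2n$ containing, for each node $i\in\{1,\ldots,n\}$, one primary visit and one secondary visit of $i$, such that the primary visit of $i$ is at a position $t_i\le d_i$, and the secondary visit of $i$ is either before its primary visit or at a position at most $t_i+d_i$. The induced deadline of node $i$ is $d_i'=d_i+t_i$, where $t_i$ is the position of its primary visit. The discretized sequence $A=\langle a_1,\ldots,a_n\rangle$ is defined by $a_n=d_n$ and $a_i=\min\{a_{i+1}-1,d_i\}$ for $i<n$. A position $j\in\{1,\ldots,2n\}$ is a gap if $j\notin\{a_1,\ldots,a_n\}$. -}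

module Defs where

open import Data.Nat using (ℕ; _+_; _*_; _∸_; _⊓_; _≤_; _<_)
open import Data.Fin using (Fin)
import Data.Fin as F
open import Data.Vec using (Vec; []; _∷_; lookup; head)
open import Data.Product using (_×_)
open import Data.Sum using (_⊎_)
open import Relation.Binary.PropositionalEquality using (_≡_; _≢_)

-- An instance of 2-Visits: d₁,…,dₙ given as a vector (node i ↦ lookup d i,
-- nodes indexed 0..n-1 by Fin n).

Positive : ∀ {n} → Vec ℕ n → Set
Positive {n} d = (i : Fin n) → 1 ≤ lookup d i

NonDecreasing : ∀ {n} → Vec ℕ n → Set
NonDecreasing {n} d = (i j : Fin n) → i F.≤ j → lookup d i ≤ lookup d j

-- A schedule: a sequence of length 2n over positions 1..2n containing, for each
-- node i, one primary visit (at position prim i) and one secondary visit (at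
-- position sec i).  Every position holds exactly one visit: the 2n visit
-- positions lie in 1..2n and are pairwise distinct (hence form a bijection).
record Schedule (n : ℕ) : Set where
  field
    prim      : Fin n → ℕ
    sec       : Fin n → ℕ
    prim-pos  : (i : Fin n) → 1 ≤ prim i × prim i ≤ 2 * n
    sec-pos   : (i : Fin n) → 1 ≤ sec i × sec i ≤ 2 * n
    prim-inj  : (i j : Fin n) → prim i ≡ prim j → i ≡ j
    sec-inj   : (i j : Fin n) → sec i ≡ sec j → i ≡ j
    prim≢sec  : (i j : Fin n) → prim i ≢ sec j
open Schedule public

Feasible : ∀ {n} → Vec ℕ n → Schedule n → Set
Feasible {n} d S = (i : Fin n) →
  (prim S i ≤ lookup d i) × (sec S i < prim S i ⊎ sec S i ≤ prim S i + lookup d i)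

inducedDeadline : ∀ {n} → Vec ℕ n → Schedule n → Fin n → ℕ
inducedDeadline d S i = lookup d i + prim S i

-- Discretized sequence: a_n = d_n, a_i = min (a_{i+1} - 1) d_i.
-- (Truncated subtraction: a value is 0 here exactly when the integer value
-- would be ≤ 0; this does not affect which positions in 1..2n are gaps.)
discretize : ∀ {n} → Vec ℕ n → Vec ℕ n
discretize [] = []
discretize (x ∷ []) = x ∷ []
discretize (x ∷ xs@(_ ∷ _)) = ((head (discretize xs) ∸ 1) ⊓ x) ∷ discretize xs

Gap : ∀ {n} → Vec ℕ n → ℕ → Set
Gap {n} d j = (1 ≤ j × j ≤ 2 * n) × ((i : Fin n) → lookup (discretize d) i ≢ j)

-- Two exchange arguments, each terminating because a bounded potential
-- strictly increases.
--
-- (1) Suppose the secondary visit of some node sits at a non-gap position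
-- q = a_k.  Unwinding the recursion for a_k gives r ≥ k with
-- d_r = q + (r − k), and the nodes k, …, r all have deadlines in
-- [q, q + (r − k)].  They cannot all have their primary visits in the r − k
-- positions q + 1, …, q + (r − k), so one of them, i, has t_i < q ≤ d_i.
-- Exchanging the visits at positions t_i and q keeps the schedule feasible
-- and increases Σ t_i.
--
-- (2) If two secondary visits at s_i < s_j have induced deadlines
-- d'_j < d'_i, exchanging them keeps feasibility (the primary visits do not
-- move) and the gap property, and increases Σ s_k d'_k by the rearrangement
-- inequality.
module Submission where

open import Defs
open import Algebra.Properties.CommutativeSemigroup using (xy∙z≈zy∙x; xy∙z≈xz∙y; xy∙z≈x∙zy)
open import Data.Empty using (⊥-elim)
open import Data.Fin as Fin using (Fin; zero; suc; toℕ; fromℕ<)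
import Data.Fin.Properties as Fin
open import Data.Nat using (ℕ; zero; suc; _+_; _*_; _∸_; _⊓_; _≤_; _<_; z≤n; s≤s; _≟_; _<?_; _≤?_)
open import Data.Nat.Properties
open import Data.Nat.Tactic.RingSolver using (solve-∀)
open import Data.Product using (Σ-syntax; _×_; _,_; proj₁; proj₂)
open import Data.Sum using (_⊎_; inj₁; inj₂; [_,_]′)
open import Data.Vec using (Vec; []; _∷_; lookup; head)
open import Data.Vec.Functional using (Vector; updateAt)
open import Data.Vec.Functional.Properties using (updateAt-updates; updateAt-minimal)
open import Function using (_∘_; const)
open import Function.Definitions using (Injective)
open import Relation.Nullary using (Dec; yes; no; contradiction)
open import Relation.Nullary.Decidable using (_×-dec_)
open import Relation.Binary.PropositionalEquality

open import Algebra.Properties.Monoid.Sum +-0-monoid using (sum; sum-cong-≗)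

sum-mono-≤ : ∀ {n} {f g : Vector ℕ n} → (∀ i → f i ≤ g i) → sum f ≤ sum g
sum-mono-≤ {zero}  f≤g = z≤n
sum-mono-≤ {suc n} f≤g = +-mono-≤ (f≤g zero) (sum-mono-≤ (f≤g ∘ suc))

sum-mono-< : ∀ {n} {f g : Vector ℕ n} → (∀ i → f i ≤ g i) → ∀ i → f i < g i → sum f < sum g
sum-mono-< f≤g zero    fi<gi = +-mono-<-≤ fi<gi (sum-mono-≤ (f≤g ∘ suc))
sum-mono-< f≤g (suc i) fi<gi = +-mono-≤-< (f≤g zero) (sum-mono-< (f≤g ∘ suc) i fi<gi)

sum-updateAt : ∀ {n} (f : Vector ℕ n) i v → sum (updateAt f i (const v)) + f i ≡ sum f + v
sum-updateAt f zero    v = xy∙z≈zy∙x +-commutativeSemigroup v (sum (f ∘ suc)) (f zero)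
sum-updateAt f (suc i) v = begin
  f zero + u + f (suc i)        ≡⟨ +-assoc (f zero) u _ ⟩
  f zero + (u + f (suc i))      ≡⟨ cong (f zero +_) (sum-updateAt (f ∘ suc) i v) ⟩
  f zero + (sum (f ∘ suc) + v)  ≡⟨ +-assoc (f zero) _ v ⟨
  f zero + sum (f ∘ suc) + v    ∎
  where
  open ≡-Reasoning
  u = sum (updateAt (f ∘ suc) i (const v))

sum-exchange-< : ∀ {n} {f g : Vector ℕ n} {i j} → i ≢ j →
                 (∀ k → k ≢ i → k ≢ j → f k ≡ g k) →
                 f i + f j < g i + g j → sum f < sum g
sum-exchange-< {n} {f} {g} {i} {j} i≢j agree fij<gij =
  +-cancelʳ-< (g i + g j) (sum f) (sum g) (begin-strict
    sum f + (g i + g j)  ≡⟨ exchange ⟩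
    sum g + (f i + f j)  <⟨ +-monoʳ-< (sum g) fij<gij ⟩
    sum g + (g i + g j)  ∎)
  where
  open ≤-Reasoning
  f₁ g₁ : Vector ℕ n
  f₁ = updateAt f i (const (g i))
  g₁ = updateAt f₁ j (const (g j))
  g₁≗g : ∀ k → g₁ k ≡ g k
  g₁≗g k with k Fin.≟ j | k Fin.≟ i
  ... | yes refl | _        = updateAt-updates k f₁
  ... | no k≢j   | yes refl = trans (updateAt-minimal k j f₁ k≢j) (updateAt-updates k f)
  ... | no k≢j   | no k≢i   =
    trans (updateAt-minimal k j f₁ k≢j) (trans (updateAt-minimal k i f k≢i) (agree k k≢i k≢j))
  f₁j≡fj : f₁ j ≡ f j
  f₁j≡fj = updateAt-minimal j i f (i≢j ∘ sym)
  exchange : sum f + (g i + g j) ≡ sum g + (f i + f j)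
  exchange = begin-equality
    sum f + (g i + g j)   ≡⟨ +-assoc (sum f) _ _ ⟨
    sum f + g i + g j     ≡⟨ cong (_+ g j) (sum-updateAt f i (g i)) ⟨
    sum f₁ + f i + g j    ≡⟨ xy∙z≈xz∙y +-commutativeSemigroup (sum f₁) (f i) (g j) ⟩
    sum f₁ + g j + f i    ≡⟨ cong (_+ f i) (sum-updateAt f₁ j (g j)) ⟨
    sum g₁ + f₁ j + f i   ≡⟨ cong₂ (λ s t → s + t + f i) (sum-cong-≗ g₁≗g) f₁j≡fj ⟩
    sum g + f j + f i     ≡⟨ xy∙z≈x∙zy +-commutativeSemigroup (sum g) (f j) (f i) ⟩
    sum g + (f i + f j)   ∎

rearrangement : ∀ {a b x y} → a < b → y < x → a * x + b * y < b * x + a * y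
rearrangement {a} {b} {x} {y} a<b y<x = begin-strict
  a * x + b * y          <⟨ m<m+n _ (*-mono-≤ (m<n⇒0<n∸m a<b) (m<n⇒0<n∸m y<x)) ⟩
  a * x + b * y + u * v  ≡⟨ identity ⟩
  b * x + a * y          ∎
  where
  open ≤-Reasoning
  u v : ℕ
  u = b ∸ a
  v = x ∸ y
  expand : ∀ a u y v → a * (y + v) + (a + u) * y + u * v ≡ (a + u) * (y + v) + a * y
  expand = solve-∀
  identity : a * x + b * y + u * v ≡ b * x + a * y
  identity = subst₂ (λ b′ x′ → a * x′ + b′ * y + u * v ≡ b′ * x′ + a * y)
                    (m+[n∸m]≡n (<⇒≤ a<b)) (m+[n∸m]≡n (<⇒≤ y<x)) (expand a u y v)

module _ {A : Set} (potential : A → ℕ) {bound : ℕ} (potential≤bound : ∀ x → potential x ≤ bound) where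

  ascend : {P Q : A → Set} →
           (∀ x → P x → Q x ⊎ Σ[ y ∈ A ] (P y × potential x < potential y)) →
           ∀ x → P x → Σ[ y ∈ A ] Q y
  ascend {P} {Q} step x Px = go (suc (bound ∸ potential x)) x Px ≤-refl
    where
    go : ∀ fuel x → P x → bound ∸ potential x < fuel → Σ[ y ∈ A ] Q y
    go zero       x Px ()
    go (suc fuel) x Px enough with step x Px
    ... | inj₁ Qx            = x , Qx
    ... | inj₂ (y , Py , up) =
      go fuel y Py (<-≤-trans (∸-monoʳ-< up (potential≤bound y)) (<⇒≤pred enough))

injective-into-interval⇒≤ : ∀ {m lo b} (f : Fin m → ℕ) → Injective _≡_ _≡_ f →
                            (∀ x → lo ≤ f x × f x < lo + b) → m ≤ b
injective-into-interval⇒≤ {m} {lo} {b} f f-injective f∈ = Fin.injective⇒≤ offset-injective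
  where
  offset< : ∀ x → f x ∸ lo < b
  offset< x = <-≤-trans (∸-monoˡ-< (proj₂ (f∈ x)) (proj₁ (f∈ x))) (≤-reflexive (m+n∸m≡n lo b))
  offset : Fin m → Fin b
  offset x = fromℕ< (offset< x)
  offset-injective : Injective _≡_ _≡_ offset
  offset-injective {x} {y} eq = f-injective (∸-cancelʳ-≡ (proj₁ (f∈ x)) (proj₁ (f∈ y))
    (trans (sym (Fin.toℕ-fromℕ< (offset< x))) (trans (cong toℕ eq) (Fin.toℕ-fromℕ< (offset< y)))))

segment-into-interval⇒≤ : ∀ {n lo b} (f : Fin n → ℕ) → Injective _≡_ _≡_ f →
                          ∀ {k r : Fin n} → toℕ k ≤ toℕ r →
                          (∀ i → toℕ k ≤ toℕ i → toℕ i ≤ toℕ r → lo ≤ f i × f i < lo + b) →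
                          suc (toℕ r ∸ toℕ k) ≤ b
segment-into-interval⇒≤ {n} {lo} {b} f f-injective {k} {r} k≤r f∈ =
  injective-into-interval⇒≤ (f ∘ node) (node-injective ∘ f-injective) node∈
  where
  k+x≤r : ∀ (x : Fin (suc (toℕ r ∸ toℕ k))) → toℕ k + toℕ x ≤ toℕ r
  k+x≤r x = ≤-trans (+-monoʳ-≤ (toℕ k) (<⇒≤pred (Fin.toℕ<n x))) (≤-reflexive (m+[n∸m]≡n k≤r))
  node : Fin (suc (toℕ r ∸ toℕ k)) → Fin n
  node x = fromℕ< (≤-<-trans (k+x≤r x) (Fin.toℕ<n r))
  toℕ-node : ∀ x → toℕ (node x) ≡ toℕ k + toℕ x
  toℕ-node x = Fin.toℕ-fromℕ< _
  node-injective : Injective _≡_ _≡_ node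
  node-injective {x} {y} eq = Fin.toℕ-injective (+-cancelˡ-≡ (toℕ k) _ _
    (trans (sym (toℕ-node x)) (trans (cong toℕ eq) (toℕ-node y))))
  node∈ : ∀ x → lo ≤ f (node x) × f (node x) < lo + b
  node∈ x = f∈ (node x) (≤-trans (m≤m+n (toℕ k) (toℕ x)) (≤-reflexive (sym (toℕ-node x))))
                        (≤-trans (≤-reflexive (toℕ-node x)) (k+x≤r x))

transpose : ℕ → ℕ → ℕ → ℕ
transpose p q x with x ≟ p | x ≟ q
... | yes _ | _     = q
... | no _  | yes _ = p
... | no _  | no _  = x

transpose-ˡ : ∀ p q → transpose p q p ≡ q
transpose-ˡ p q with p ≟ p
... | yes _   = refl
... | no p≢p  = contradiction refl p≢p

transpose-ʳ : ∀ p q → transpose p q q ≡ p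
transpose-ʳ p q with q ≟ p | q ≟ q
... | yes q≡p | _       = q≡p
... | no _    | yes _   = refl
... | no _    | no q≢q  = contradiction refl q≢q

transpose-fixed : ∀ {p q x} → x ≢ p → x ≢ q → transpose p q x ≡ x
transpose-fixed {p} {q} {x} x≢p x≢q with x ≟ p | x ≟ q
... | yes x≡p | _       = contradiction x≡p x≢p
... | no _    | yes x≡q = contradiction x≡q x≢q
... | no _    | no _    = refl

transpose-involutive : ∀ p q x → transpose p q (transpose p q x) ≡ x
transpose-involutive p q x with x ≟ p | x ≟ q
... | yes refl | _        = transpose-ʳ p q
... | no _     | yes refl = transpose-ˡ p q
... | no x≢p   | no x≢q   = transpose-fixed x≢p x≢q

transpose-injective : ∀ p q → Injective _≡_ _≡_ (transpose p q)
transpose-injective p q {x} {y} eq =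
  trans (sym (transpose-involutive p q x)) (trans (cong (transpose p q) eq) (transpose-involutive p q y))

transpose-preserves : ∀ (P : ℕ → Set) {p q x} → P p → P q → P x → P (transpose p q x)
transpose-preserves P {p} {q} {x} Pp Pq Px with x ≟ p | x ≟ q
... | yes _ | _     = Pq
... | no _  | yes _ = Pp
... | no _  | no _  = Px

transpose-≥ : ∀ {p q x} → p ≤ q → x ≢ q → x ≤ transpose p q x
transpose-≥ {p} {q} {x} p≤q x≢q with x ≟ p | x ≟ q
... | yes refl | _       = p≤q
... | no _     | yes x≡q = contradiction x≡q x≢q
... | no _     | no _    = ≤-refl

transpose-≤ : ∀ {p q x} → p ≤ q → x ≢ p → transpose p q x ≤ x
transpose-≤ {p} {q} {x} p≤q x≢p with x ≟ p | x ≟ q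
... | yes x≡p | _        = contradiction x≡p x≢p
... | no _    | yes refl = p≤q
... | no _    | no _     = ≤-refl

IsPosition : ℕ → ℕ → Set
IsPosition n p = 1 ≤ p × p ≤ 2 * n

swapPositions : ∀ {n} (S : Schedule n) {p q} → IsPosition n p → IsPosition n q → Schedule n
swapPositions {n} S {p} {q} p-pos q-pos = record
  { prim     = transpose p q ∘ prim S
  ; sec      = transpose p q ∘ sec S
  ; prim-pos = λ i → transpose-preserves (IsPosition n) p-pos q-pos (prim-pos S i)
  ; sec-pos  = λ i → transpose-preserves (IsPosition n) p-pos q-pos (sec-pos S i)
  ; prim-inj = λ i j → prim-inj S i j ∘ transpose-injective p q
  ; sec-inj  = λ i j → sec-inj S i j ∘ transpose-injective p q
  ; prim≢sec = λ i j → prim≢sec S i j ∘ transpose-injective p q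
  }

-- The first alternative in Feasible implies the second, so feasibility only
-- asks for t_i ≤ d_i and s_i ≤ d'_i.
sec≤inducedDeadline : ∀ {n} (d : Vec ℕ n) {S} → Feasible d S → ∀ i → sec S i ≤ inducedDeadline d S i
sec≤inducedDeadline d {S} S-feasible i with proj₂ (S-feasible i)
... | inj₁ s<t   = ≤-trans (<⇒≤ s<t) (m≤n+m (prim S i) (lookup d i))
... | inj₂ s≤t+d = ≤-trans s≤t+d (≤-reflexive (+-comm (prim S i) (lookup d i)))

feasible : ∀ {n} (d : Vec ℕ n) S → (∀ i → prim S i ≤ lookup d i) →
           (∀ i → sec S i ≤ inducedDeadline d S i) → Feasible d S
feasible d S t≤d s≤d′ i =
  t≤d i , inj₂ (≤-trans (s≤d′ i) (≤-reflexive (+-comm (lookup d i) (prim S i))))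

SecondariesAtGaps : ∀ {n} → Vec ℕ n → Schedule n → Set
SecondariesAtGaps {n} d S = (i : Fin n) → Gap d (sec S i)

SecondariesSorted : ∀ {n} → Vec ℕ n → Schedule n → Set
SecondariesSorted {n} d S = (i j : Fin n) → sec S i < sec S j →
  inducedDeadline d S i ≤ inducedDeadline d S j

weightedSecondarySum : ∀ {n} → Vec ℕ n → Schedule n → ℕ
weightedSecondarySum d S = sum (λ k → sec S k * inducedDeadline d S k)

head≡lookup-zero : ∀ {m} {A : Set} (v : Vec A (suc m)) → head v ≡ lookup v zero
head≡lookup-zero (x ∷ _) = refl

discretize-≤ : ∀ {n} (d : Vec ℕ n) k → lookup (discretize d) k ≤ lookup d k
discretize-≤ (x ∷ [])     zero    = ≤-refl
discretize-≤ (x ∷ y ∷ ys) zero    = m⊓n≤n _ x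
discretize-≤ (x ∷ y ∷ ys) (suc k) = discretize-≤ (y ∷ ys) k

discretize-monotone : ∀ {n} (d : Vec ℕ n) {k i} → k Fin.≤ i →
                      lookup (discretize d) k ≤ lookup (discretize d) i
discretize-monotone (x ∷ [])     {zero}  {zero}  _       = ≤-refl
discretize-monotone (x ∷ y ∷ ys) {zero}  {zero}  _       = ≤-refl
discretize-monotone (x ∷ y ∷ ys) {zero}  {suc i} _       = begin
  (head (discretize (y ∷ ys)) ∸ 1) ⊓ x  ≤⟨ m⊓n≤m _ x ⟩
  head (discretize (y ∷ ys)) ∸ 1        ≤⟨ m∸n≤m _ 1 ⟩
  head (discretize (y ∷ ys))            ≡⟨ head≡lookup-zero (discretize (y ∷ ys)) ⟩
  lookup (discretize (y ∷ ys)) zero     ≤⟨ discretize-monotone (y ∷ ys) z≤n ⟩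
  lookup (discretize (y ∷ ys)) i        ∎
  where open ≤-Reasoning
discretize-monotone (x ∷ y ∷ ys) {suc k} {suc i} (s≤s k≤i) = discretize-monotone (y ∷ ys) k≤i

m∸1≡n⇒m≡1+n : ∀ {m n} → 1 ≤ n → m ∸ 1 ≡ n → m ≡ suc n
m∸1≡n⇒m≡1+n {suc m} _ refl = refl

discretize-attained : ∀ {n} (d : Vec ℕ n) k {q} → 1 ≤ q → lookup (discretize d) k ≡ q →
                      Σ[ r ∈ Fin n ] (toℕ k ≤ toℕ r × lookup d r ≡ q + (toℕ r ∸ toℕ k))
discretize-attained (x ∷ [])     zero    _   refl = zero , z≤n , sym (+-identityʳ x)
discretize-attained (x ∷ y ∷ ys) (suc k) q≥1 eq
  with r , k≤r , dr ← discretize-attained (y ∷ ys) k q≥1 eq = suc r , s≤s k≤r , dr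
discretize-attained {suc (suc m)} (x ∷ y ∷ ys) zero {q} q≥1 eq =
  [ (λ ⊓≡pred → shift (discretize-attained (y ∷ ys) zero (s≤s z≤n) (head≡1+q ⊓≡pred)))
  , (λ ⊓≡x → zero , z≤n , trans (trans (sym ⊓≡x) eq) (sym (+-identityʳ q)))
  ]′ (⊓-sel (head (discretize (y ∷ ys)) ∸ 1) x)
  where
  head≡1+q : (head (discretize (y ∷ ys)) ∸ 1) ⊓ x ≡ head (discretize (y ∷ ys)) ∸ 1 →
             lookup (discretize (y ∷ ys)) zero ≡ suc q
  head≡1+q ⊓≡pred =
    trans (sym (head≡lookup-zero (discretize (y ∷ ys)))) (m∸1≡n⇒m≡1+n q≥1 (trans (sym ⊓≡pred) eq))
  shift : Σ[ r ∈ Fin (suc m) ] (0 ≤ toℕ r × lookup (y ∷ ys) r ≡ suc q + toℕ r) →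
          Σ[ r ∈ Fin (suc (suc m)) ] (0 ≤ toℕ r × lookup (x ∷ y ∷ ys) r ≡ q + toℕ r)
  shift (r , _ , dr) = suc r , z≤n , trans dr (sym (+-suc q (toℕ r)))

module _ {n} (d : Vec ℕ n) (S : Schedule n) (S-feasible : Feasible d S) where

  private
    sec≤d′ : ∀ k → sec S k ≤ inducedDeadline d S k
    sec≤d′ = sec≤inducedDeadline d {S} S-feasible

  promote-secondary : ∀ {i j} → prim S i < sec S j → sec S j ≤ lookup d i →
                      Σ[ T ∈ Schedule n ] (Feasible d T × sum (prim S) < sum (prim T))
  promote-secondary {i} {j} t<s s≤d =
    T , feasible d T primT≤d secT≤d′ , sum-mono-< prim≤primT i (subst (prim S i <_) (sym primT-i) t<s)
    where
    T : Schedule n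
    T = swapPositions S (prim-pos S i) (sec-pos S j)
    primT-i : prim T i ≡ sec S j
    primT-i = transpose-ˡ (prim S i) (sec S j)
    prim≤primT : ∀ k → prim S k ≤ prim T k
    prim≤primT k = transpose-≥ (<⇒≤ t<s) (prim≢sec S k j)
    secT≤sec : ∀ k → sec T k ≤ sec S k
    secT≤sec k = transpose-≤ (<⇒≤ t<s) (prim≢sec S i k ∘ sym)
    primT≤d : ∀ k → prim T k ≤ lookup d k
    primT≤d k with k Fin.≟ i
    ... | yes refl = ≤-trans (≤-reflexive primT-i) s≤d
    ... | no k≢i   = ≤-trans (≤-reflexive (transpose-fixed (k≢i ∘ prim-inj S k i) (prim≢sec S k j)))
                             (proj₁ (S-feasible k))
    secT≤d′ : ∀ k → sec T k ≤ inducedDeadline d T k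
    secT≤d′ k = ≤-trans (secT≤sec k) (≤-trans (sec≤d′ k)
                                               (+-monoʳ-≤ (lookup d k) (prim≤primT k)))

  module _ {i j} (si<sj : sec S i < sec S j) (d′j<d′i : inducedDeadline d S j < inducedDeadline d S i) where

    private
      d′ : Fin n → ℕ
      d′ = inducedDeadline d S
      T : Schedule n
      T = swapPositions S (sec-pos S i) (sec-pos S j)
      i≢j : i ≢ j
      i≢j refl = <-irrefl refl si<sj
      primT≡prim : ∀ k → prim T k ≡ prim S k
      primT≡prim k = transpose-fixed (prim≢sec S k i) (prim≢sec S k j)
      d′T≡d′ : ∀ k → inducedDeadline d T k ≡ d′ k
      d′T≡d′ k = cong (lookup d k +_) (primT≡prim k)
      secT-i : sec T i ≡ sec S j
      secT-i = transpose-ˡ (sec S i) (sec S j)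
      secT-j : sec T j ≡ sec S i
      secT-j = transpose-ʳ (sec S i) (sec S j)
      secT-other : ∀ {k} → k ≢ i → k ≢ j → sec T k ≡ sec S k
      secT-other k≢i k≢j = transpose-fixed (k≢i ∘ sec-inj S _ i) (k≢j ∘ sec-inj S _ j)

      secT≤d′ : ∀ k → Dec (k ≡ i) → Dec (k ≡ j) → sec T k ≤ d′ k
      secT≤d′ k (yes refl) _          = begin
        sec T k  ≡⟨ secT-i ⟩ sec S j  ≤⟨ sec≤d′ j ⟩ d′ j  <⟨ d′j<d′i ⟩ d′ k ∎
        where open ≤-Reasoning
      secT≤d′ k (no _)     (yes refl) = begin
        sec T k  ≡⟨ secT-j ⟩ sec S i  <⟨ si<sj ⟩ sec S k  ≤⟨ sec≤d′ k ⟩ d′ k ∎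
        where open ≤-Reasoning
      secT≤d′ k (no k≢i)   (no k≢j)   = ≤-trans (≤-reflexive (secT-other k≢i k≢j)) (sec≤d′ k)

      T-feasible : Feasible d T
      T-feasible = feasible d T
        (λ k → ≤-trans (≤-reflexive (primT≡prim k)) (proj₁ (S-feasible k)))
        (λ k → ≤-trans (secT≤d′ k (k Fin.≟ i) (k Fin.≟ j)) (≤-reflexive (sym (d′T≡d′ k))))

      weighted< : weightedSecondarySum d S < weightedSecondarySum d T
      weighted< = sum-exchange-< i≢j agree (begin-strict
        sec S i * d′ i + sec S j * d′ j   <⟨ rearrangement si<sj d′j<d′i ⟩
        sec S j * d′ i + sec S i * d′ j   ≡⟨ cong₂ _+_ (cong₂ _*_ secT-i (d′T≡d′ i))
                                                      (cong₂ _*_ secT-j (d′T≡d′ j)) ⟨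
        sec T i * inducedDeadline d T i + sec T j * inducedDeadline d T j ∎)
        where
        open ≤-Reasoning
        agree : ∀ k → k ≢ i → k ≢ j → sec S k * d′ k ≡ sec T k * inducedDeadline d T k
        agree k k≢i k≢j = sym (cong₂ _*_ (secT-other k≢i k≢j) (d′T≡d′ k))

    exchange-secondaries : SecondariesAtGaps d S →
                           Σ[ T ∈ Schedule n ] ((Feasible d T × SecondariesAtGaps d T)
                                                × weightedSecondarySum d S < weightedSecondarySum d T)
    exchange-secondaries gaps =
      T , (T-feasible , λ k → transpose-preserves (Gap d) (gaps i) (gaps j) (gaps k)) , weighted<

secondary-at-nonGap-promotable : ∀ {n} (d : Vec ℕ n) S → NonDecreasing d → Feasible d S →
                                 ∀ {j k} → lookup (discretize d) k ≡ sec S j →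
                                 Σ[ i ∈ Fin n ] (prim S i < sec S j × sec S j ≤ lookup d i)
secondary-at-nonGap-promotable d S d-mono S-feasible {j} {k} a≡q
  with r , k≤r , d-r ← discretize-attained d k (proj₁ (sec-pos S j)) a≡q
  with Fin.any? (λ i → prim S i <? sec S j ×-dec sec S j ≤? lookup d i)
... | yes found = found
... | no none   = ⊥-elim (1+n≰n (segment-into-interval⇒≤ (prim S) (λ {x y} → prim-inj S x y) k≤r t∈))
  where
  q : ℕ
  q = sec S j
  t∈ : ∀ i → toℕ k ≤ toℕ i → toℕ i ≤ toℕ r → suc q ≤ prim S i × prim S i < suc q + (toℕ r ∸ toℕ k)
  t∈ i k≤i i≤r = ≤∧≢⇒< (≮⇒≥ (λ t<q → none (i , t<q , q≤d))) (prim≢sec S i j ∘ sym) , s≤s t≤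
    where
    open ≤-Reasoning
    q≤d : q ≤ lookup d i
    q≤d = begin
      q                           ≡⟨ a≡q ⟨
      lookup (discretize d) k     ≤⟨ discretize-monotone d k≤i ⟩
      lookup (discretize d) i     ≤⟨ discretize-≤ d i ⟩
      lookup d i                  ∎
    t≤ : prim S i ≤ q + (toℕ r ∸ toℕ k)
    t≤ = begin
      prim S i                ≤⟨ proj₁ (S-feasible i) ⟩
      lookup d i              ≤⟨ d-mono i r i≤r ⟩
      lookup d r              ≡⟨ d-r ⟩
      q + (toℕ r ∸ toℕ k)     ∎

secondaries-at-gaps : ∀ {n} (d : Vec ℕ n) → NonDecreasing d →
                      ∀ S → Feasible d S → Σ[ T ∈ Schedule n ] (Feasible d T × SecondariesAtGaps d T)
secondaries-at-gaps {n} d d-mono = ascend (sum ∘ prim) primSum≤ step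
  where
  primSum≤ : ∀ S → sum (prim S) ≤ sum (λ (_ : Fin n) → 2 * n)
  primSum≤ S = sum-mono-≤ (proj₂ ∘ prim-pos S)
  step : ∀ S → Feasible d S → (Feasible d S × SecondariesAtGaps d S)
                              ⊎ Σ[ T ∈ Schedule n ] (Feasible d T × sum (prim S) < sum (prim T))
  step S S-feasible with Fin.any? (λ j → Fin.any? (λ k → lookup (discretize d) k ≟ sec S j))
  ... | no noHit = inj₁ (S-feasible , λ j → sec-pos S j , λ k a≡s → noHit (j , k , a≡s))
  ... | yes (j , k , a≡s)
    with i , t<s , s≤d ← secondary-at-nonGap-promotable d S d-mono S-feasible a≡s
    = inj₂ (promote-secondary d S S-feasible t<s s≤d)

secondaries-sorted : ∀ {n} (d : Vec ℕ n) S → Feasible d S × SecondariesAtGaps d S →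
                     Σ[ T ∈ Schedule n ] (Feasible d T × SecondariesAtGaps d T × SecondariesSorted d T)
secondaries-sorted {n} d = ascend (weightedSecondarySum d) weighted≤ step
  where
  weighted≤ : ∀ S → weightedSecondarySum d S ≤ sum (λ k → 2 * n * (lookup d k + 2 * n))
  weighted≤ S = sum-mono-≤ (λ k → *-mono-≤ (proj₂ (sec-pos S k))
                                             (+-monoʳ-≤ (lookup d k) (proj₂ (prim-pos S k))))
  step : ∀ S → Feasible d S × SecondariesAtGaps d S →
         (Feasible d S × SecondariesAtGaps d S × SecondariesSorted d S)
         ⊎ Σ[ T ∈ Schedule n ] ((Feasible d T × SecondariesAtGaps d T)
                                × weightedSecondarySum d S < weightedSecondarySum d T)
  step S (S-feasible , gaps)
    with Fin.any? (λ i → Fin.any? (λ j → sec S i <? sec S j ×-dec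
                                         inducedDeadline d S j <? inducedDeadline d S i))
  ... | no noInversion = inj₁ (S-feasible , gaps , λ i j si<sj →
    ≮⇒≥ (λ d′j<d′i → noInversion (i , j , si<sj , d′j<d′i)))
  ... | yes (i , j , si<sj , d′j<d′i) = inj₂ (exchange-secondaries d S S-feasible si<sj d′j<d′i gaps)

theorem1 : (n : ℕ) (d : Vec ℕ n) → Positive d → NonDecreasing d →
    Σ[ S ∈ Schedule n ] Feasible d S →
    Σ[ S ∈ Schedule n ] (Feasible d S
      × ((i : Fin n) → Gap d (sec S i))
      × ((i j : Fin n) → sec S i < sec S j →
           inducedDeadline d S i ≤ inducedDeadline d S j))
theorem1 n d _ d-mono (S , S-feasible) =
  let T , T-feasible , T-gaps = secondaries-at-gaps d d-mono S S-feasible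
  in secondaries-sorted d T (T-feasible , T-gaps)
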